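{- Let $G=(V,E)$ be a directed cactus graph with vertex set $V=\{1,2,\ldots,n\}$, i.e. a strongly connected simple digraph in which every directed edge is contained in exactly one directed cycle. Let $L$ be the Laplacian matrix of $G$, let $L^\dagger=(l^\dagger_{ij})$ be its Moore–Penrose inverse, and define the resistance $r_{ij}:=l^\dagger_{ii}+l^\dagger_{jj}-2l^\dagger_{ij}$ for $i,j\in V$. Let $d_{ij}$ denote the length of a shortest directed path from $i$ to $j$ (with $d_{ii}:=0$). Then $r_{ij}\le d_{ij}$ for all $i,j\in V$.
   Context: For a simple digraph $G=(V,E)$ on $V=\{1,\dots,n\}$, $(i,j)\in E$ means there is a directed edge from $i$ to $j$. The outdegree of $i$ is $\delta_i^{out}=|\{j:(i,j)\in E\}|$ and the indegree is $\delta_i^{in}=|\{j:(j,i)\in E\}|$. The Laplacian $L=(l_{ij})$ is defined by $l_{ii}=\delta_i^{out}$, $l_{ij}=-1$ if $i\neq j$ and $(i,j)\in E$, and $l_{ij}=0$ otherwise. A digraph is strongly connected if there is a directed path from any vertex to any other vertex. (A directed cactus is automatically balanced, i.e. $\delta_i^{in}=\delta_i^{out}$ for all $i$.) -}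

module Defs where

open import Data.Nat using (ℕ; zero; suc; _≤_)
open import Data.Integer using (+_)
open import Data.Bool using (Bool; true; false; if_then_else_)
open import Data.Fin using (Fin; zero; suc; _≟_)
open import Data.Product using (_×_; _,_; ∃)
open import Data.List using (List; []; _∷_; _++_; [_]; length)
open import Data.List.Membership.Propositional using (_∈_)
open import Data.List.Relation.Unary.All using (All)
open import Data.List.Relation.Unary.Unique.Propositional using (Unique)
open import Data.Rational using (ℚ; 0ℚ; _+_; _*_; _-_; _/_)
open import Relation.Binary.PropositionalEquality using (_≡_)
open import Relation.Nullary using (yes; no)
open import Function.Bundles using (_⇔_)

Digraph : ℕ → Set
Digraph n = Fin n → Fin n → Bool

-- Simple: no loops (no multi-edges is automatic for a Bool-valued relation).
Simple : ∀ {n} → Digraph n → Set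
Simple {n} E = (i : Fin n) → E i i ≡ false

count : ∀ {n} → (Fin n → Bool) → ℕ
count {zero} p = 0
count {suc n} p = (if p zero then 1 else 0) Data.Nat.+ count (λ i → p (suc i))

outdeg : ∀ {n} → Digraph n → Fin n → ℕ
outdeg E i = count (E i)

Σℚ : ∀ {n} → (Fin n → ℚ) → ℚ
Σℚ {zero} f = 0ℚ
Σℚ {suc n} f = f zero + Σℚ (λ i → f (suc i))

Matrix : ℕ → Set
Matrix n = Fin n → Fin n → ℚ

ℕtoℚ : ℕ → ℚ
ℕtoℚ k = (+ k) / 1

laplacian : ∀ {n} → Digraph n → Matrix n
laplacian E i j with i ≟ j
... | yes _ = ℕtoℚ (outdeg E i)
... | no _ = if E i j then Data.Rational.-_ (ℕtoℚ 1) else 0ℚ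

_⊗_ : ∀ {n} → Matrix n → Matrix n → Matrix n
(A ⊗ B) i j = Σℚ (λ k → A i k * B k j)

transpose : ∀ {n} → Matrix n → Matrix n
transpose A i j = A j i

-- X is the Moore–Penrose inverse of A (the four Penrose conditions; over ℚ the
-- conjugate transpose is the transpose).
IsMoorePenrose : ∀ {n} → Matrix n → Matrix n → Set
IsMoorePenrose {n} A X =
    (∀ i j → ((A ⊗ X) ⊗ A) i j ≡ A i j)
  × (∀ i j → ((X ⊗ A) ⊗ X) i j ≡ X i j)
  × (∀ i j → transpose (A ⊗ X) i j ≡ (A ⊗ X) i j)
  × (∀ i j → transpose (X ⊗ A) i j ≡ (X ⊗ A) i j)

resistance : ∀ {n} → Matrix n → Fin n → Fin n → ℚ
resistance X i j = (X i i + X j j) - (ℕtoℚ 2 * X i j)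

data Walk {n} (E : Digraph n) : Fin n → Fin n → ℕ → Set where
  nil  : ∀ {i} → Walk E i i 0
  cons : ∀ {i j l k} → E i j ≡ true → Walk E j l k → Walk E i l (suc k)

StronglyConnected : ∀ {n} → Digraph n → Set
StronglyConnected {n} E = (i j : Fin n) → ∃ λ k → Walk E i j k

IsDistance : ∀ {n} → Digraph n → Fin n → Fin n → ℕ → Set
IsDistance E i j d = Walk E i j d × (∀ k → Walk E i j k → d ≤ k)

-- Directed cycles, given as a list of distinct vertices v0 … v(m-1), m ≥ 2,
-- with edges v0→v1→…→v(m-1)→v0.
consec : {A : Set} → List A → List (A × A)
consec (x ∷ y ∷ xs) = (x , y) ∷ consec (y ∷ xs)
consec _ = []

cycleEdges : {A : Set} → List A → List (A × A)
cycleEdges [] = []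
cycleEdges (x ∷ xs) = consec ((x ∷ xs) ++ [ x ])

IsCycle : ∀ {n} → Digraph n → List (Fin n) → Set
IsCycle E vs = Unique vs × 2 ≤ length vs × All (λ e → E (Data.Product.proj₁ e) (Data.Product.proj₂ e) ≡ true) (cycleEdges vs)

OnCycle : ∀ {n} → List (Fin n) → Fin n → Fin n → Set
OnCycle vs a b = (a , b) ∈ cycleEdges vs

-- Directed cactus: strongly connected simple digraph in which every edge lies on
-- exactly one directed cycle (cycles identified by their edge sets).
IsDirectedCactus : ∀ {n} → Digraph n → Set
IsDirectedCactus {n} E =
    Simple E
  × StronglyConnected E
  × (∀ (a b : Fin n) → E a b ≡ true →
        (∃ λ vs → IsCycle E vs × OnCycle vs a b)
      × (∀ vs ws → IsCycle E vs → IsCycle E ws → OnCycle vs a b → OnCycle ws a b →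
           ∀ (c d : Fin n) → OnCycle vs c d ⇔ OnCycle ws c d))

-- Let L be the Laplacian of the cactus and X its Moore–Penrose inverse. For an edge (a, b) on
-- its cycle C, call the branch T_c at a vertex c of C the set of vertices reachable from c
-- without using edges of C. The only edges leaving and entering T_c are the two edges of C at c,
-- so y = 1 − [T_b] and z = [T_a] satisfy L y = Lᵀ z = e_a − e_b, and, T_a and T_b being
-- disjoint, z ≤ y and y_v − z_w ≤ 1 entrywise. Summing along a walk of length d from i to j
-- gives L y = Lᵀ z = e_i − e_j with z ≤ y and y_v − z_w ≤ d. As the digraph is strongly
-- connected and balanced, X L and L X both act as y ↦ y − mean(y)·1, so
-- r_ij = (X L y)_i − (L X z)_j = y_i − z_j − mean(y) + mean(z) ≤ d.

module Submission where

open import Algebra.Bundles using (CommutativeRing)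
open import Data.Bool using (Bool; true; false; not; _∧_; _∨_)
open import Data.Bool.Properties using (not-involutive; ∨-zeroʳ; ∧-conicalˡ; ∧-conicalʳ) renaming (_≟_ to _≟ᵇ_)
open import Data.Empty using (⊥; ⊥-elim)
open import Data.Fin using (Fin; zero; suc; _≟_; punchIn)
open import Data.Fin.Properties using (punchInᵢ≢i; suc-injective; any?)
import Data.Integer as ℤ
open import Data.Integer.Properties using () renaming (*-identityʳ to ℤ-*-identityʳ)
open import Data.List using (List; []; _∷_; _++_; [_]; length; map; allFin)
open import Data.List.Properties using (++-assoc; ++-identityʳ; length-++; length-tabulate; length-map)
open import Data.List.Membership.Propositional using (_∈_; _∉_)
open import Data.List.Membership.Propositional.Properties using (∈-++⁺ˡ; ∈-++⁺ʳ; ∈-++⁻; ∈-∃++; ∈-allFin; ∈-map⁺; ∈-map⁻)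
open import Data.List.Relation.Binary.Permutation.Propositional using (_↭_; ↭-sym; ↭⇒↭ₛ)
open import Data.List.Relation.Binary.Permutation.Propositional.Properties using (++-comm; ∈-resp-↭)
import Data.List.Relation.Binary.Permutation.Setoid.Properties as ↭ₛ
open import Data.List.Relation.Binary.Subset.Propositional using (_⊆_)
open import Data.List.Relation.Unary.All as All using (All; []; _∷_)
import Data.List.Relation.Unary.All.Properties as All
open import Data.List.Relation.Unary.AllPairs using ([]; _∷_)
open import Data.List.Relation.Unary.Any using (here; there)
open import Data.List.Relation.Unary.Unique.Propositional using (Unique)
import Data.List.Relation.Unary.Unique.Propositional.Properties as Unique
open import Data.Nat as ℕ using (ℕ; zero; suc; z≤n; s≤s)
import Data.Nat.Properties as ℕ
import Data.Nat.Coprimality as Coprime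
open import Data.Product using (_×_; _,_; proj₁; proj₂; ∃; uncurry)
open import Data.Product.Properties using (≡-dec)
open import Data.Rational using (ℚ; toℚᵘ; 0ℚ; 1ℚ; _+_; _*_; _-_; -_; _≤_; _≤?_; mkℚ; NonNegative)
open import Data.Rational.Properties
  using ( +-*-commutativeRing; +-identityˡ; +-identityʳ; +-inverseʳ; neg-distrib-+; *-assoc; *-comm
        ; *-identityˡ; *-zeroˡ; *-zeroʳ; *-distribˡ-+; ≤-refl; ≤-reflexive; ≤-trans; +-mono-≤; +-monoˡ-≤
        ; *-monoˡ-≤-nonNeg; *-cancelˡ-≤-pos; normalize-coprime; normalize-nonNeg; normalize-pos
        ; toℚᵘ-injective; toℚᵘ-homo-+; module ≤-Reasoning )
open import Data.Rational.Solver using (module +-*-Solver)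
import Data.Rational.Unnormalised as ℚᵘ
import Data.Rational.Unnormalised.Properties as ℚᵘ
open import Data.Sum using (_⊎_; inj₁; inj₂)
open import Data.Vec.Functional using (Vector)
open import Function using (_∘_; id)
open import Function.Bundles using (Equivalence)
open import Relation.Binary.Definitions using (DecidableEquality)
open import Relation.Binary.PropositionalEquality hiding ([_])
open import Relation.Nullary using (¬_; Dec; yes; no; does; contradiction; from-yes)

open import Defs

open import Algebra.Properties.Semiring.Sum (CommutativeRing.semiring +-*-commutativeRing)
  using (sum; sum-syntax; sum-cong-≗; sum-replicate-zero; sum-remove; ∑-distrib-+; ∑-comm; *-distribˡ-sum; *-distribʳ-sum)

open +-*-Solver

-- Finite sums of rationals

ℕtoℚ-suc : ∀ k → ℕtoℚ (suc k) ≡ 1ℚ + ℕtoℚ k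
ℕtoℚ-suc k = toℚᵘ-injective (begin
  toℚᵘ (ℕtoℚ (suc k))               ≡⟨ cong toℚᵘ (ℕtoℚ≡mkℚ (suc k)) ⟩
  ℚᵘ.mkℚᵘ (ℤ.+ suc k) 0              ≈⟨ ℚᵘ.*≡* suc-k≃1+k ⟩
  toℚᵘ 1ℚ ℚᵘ.+ ℚᵘ.mkℚᵘ (ℤ.+ k) 0     ≡⟨ cong (λ q → toℚᵘ 1ℚ ℚᵘ.+ toℚᵘ q) (ℕtoℚ≡mkℚ k) ⟨
  toℚᵘ 1ℚ ℚᵘ.+ toℚᵘ (ℕtoℚ k)         ≈⟨ ℚᵘ.≃-sym (toℚᵘ-homo-+ 1ℚ (ℕtoℚ k)) ⟩
  toℚᵘ (1ℚ + ℕtoℚ k)                 ∎)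
  where
  open import Relation.Binary.Reasoning.Setoid ℚᵘ.≃-setoid
  ℕtoℚ≡mkℚ : ∀ k → ℕtoℚ k ≡ mkℚ (ℤ.+ k) 0 (Coprime.sym (Coprime.1-coprimeTo k))
  ℕtoℚ≡mkℚ k = normalize-coprime _
  suc-k≃1+k : ℤ.+ suc k ℤ.* ℤ.+ 1 ≡ (ℤ.+ 1 ℤ.* ℤ.+ 1 ℤ.+ ℤ.+ k ℤ.* ℤ.+ 1) ℤ.* ℤ.+ 1
  suc-k≃1+k rewrite ℤ-*-identityʳ (ℤ.+ suc k) | ℤ-*-identityʳ (ℤ.+ k) | ℤ-*-identityʳ (ℤ.+ 1 ℤ.+ ℤ.+ k) = refl

Σℚ≡sum : ∀ {n} (f : Vector ℚ n) → Σℚ f ≡ sum f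
Σℚ≡sum {zero} f = refl
Σℚ≡sum {suc n} f = cong (f zero +_) (Σℚ≡sum (f ∘ suc))

∑-neg : ∀ {n} (f : Vector ℚ n) → ∑[ i < n ] (- f i) ≡ - sum f
∑-neg {zero} f = refl
∑-neg {suc n} f = trans (cong (- f zero +_) (∑-neg (f ∘ suc))) (sym (neg-distrib-+ (f zero) (sum (f ∘ suc))))

∑-distrib-- : ∀ {n} (f g : Vector ℚ n) → ∑[ i < n ] (f i - g i) ≡ sum f - sum g
∑-distrib-- f g = trans (∑-distrib-+ f (-_ ∘ g)) (cong (sum f +_) (∑-neg g))

sum-const : ∀ n (c : ℚ) → ∑[ i < n ] c ≡ ℕtoℚ n * c
sum-const zero c = sym (*-zeroˡ c)
sum-const (suc n) c = begin
  c + ∑[ i < n ] c     ≡⟨ cong (c +_) (sum-const n c) ⟩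
  c + ℕtoℚ n * c       ≡⟨ solve 2 (λ c k → c :+ k :* c := (con 1ℚ :+ k) :* c) refl c (ℕtoℚ n) ⟩
  (1ℚ + ℕtoℚ n) * c    ≡⟨ cong (_* c) (sym (ℕtoℚ-suc n)) ⟩
  ℕtoℚ (suc n) * c     ∎
  where open ≡-Reasoning

sum-mono-≤ : ∀ {n} {f g : Vector ℚ n} → (∀ i → f i ≤ g i) → sum f ≤ sum g
sum-mono-≤ {zero} f≤g = ≤-refl
sum-mono-≤ {suc n} f≤g = +-mono-≤ (f≤g zero) (sum-mono-≤ (f≤g ∘ suc))

sum-single : ∀ {n} (f : Vector ℚ n) (p : Fin n) → (∀ i → i ≢ p → f i ≡ 0ℚ) → sum f ≡ f p
sum-single {suc n} f p vanish = begin
  sum f                                        ≡⟨ sum-remove f ⟩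
  f p + ∑[ i < n ] f (punchIn p i)             ≡⟨ cong (f p +_) (sum-cong-≗ (λ i → vanish (punchIn p i) (punchInᵢ≢i p i))) ⟩
  f p + ∑[ i < n ] 0ℚ                          ≡⟨ cong (f p +_) (sum-replicate-zero n) ⟩
  f p + 0ℚ                                     ≡⟨ +-identityʳ (f p) ⟩
  f p                                          ∎
  where open ≡-Reasoning

δ : ∀ {n} → Fin n → Fin n → ℚ
δ p i with p ≟ i
... | yes _ = 1ℚ
... | no _  = 0ℚ

δ-diag : ∀ {n} (p : Fin n) → δ p p ≡ 1ℚ
δ-diag p with p ≟ p
... | yes _ = refl
... | no p≢p = contradiction refl p≢p

δ-off : ∀ {n} {p i : Fin n} → p ≢ i → δ p i ≡ 0ℚ
δ-off {p = p} {i} p≢i with p ≟ i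
... | yes p≡i = contradiction p≡i p≢i
... | no _ = refl

δ-sym : ∀ {n} (p i : Fin n) → δ p i ≡ δ i p
δ-sym p i with p ≟ i | i ≟ p
... | yes _   | yes _   = refl
... | no _    | no _    = refl
... | yes p≡i | no i≢p  = contradiction (sym p≡i) i≢p
... | no p≢i  | yes i≡p = contradiction (sym i≡p) p≢i

∑-δ* : ∀ {n} (p : Fin n) (f : Vector ℚ n) → ∑[ i < n ] (δ p i * f i) ≡ f p
∑-δ* {n} p f = begin
  ∑[ i < n ] (δ p i * f i)  ≡⟨ sum-single _ p (λ i i≢p → trans (cong (_* f i) (δ-off (i≢p ∘ sym))) (*-zeroˡ (f i))) ⟩
  δ p p * f p               ≡⟨ cong (_* f p) (δ-diag p) ⟩
  1ℚ * f p                  ≡⟨ *-identityˡ (f p) ⟩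
  f p                       ∎
  where open ≡-Reasoning

ind : Bool → ℚ
ind true = 1ℚ
ind false = 0ℚ

not-true⇒≢true : ∀ {b} → not b ≡ true → b ≢ true
not-true⇒≢true () refl

≢true⇒not-true : ∀ {b} → b ≢ true → not b ≡ true
≢true⇒not-true {true}  b≢true = contradiction refl b≢true
≢true⇒not-true {false} _      = refl

∨-true⁻ : ∀ {a b} → a ∨ b ≡ true → a ≡ true ⊎ b ≡ true
∨-true⁻ {true}  _  = inj₁ refl
∨-true⁻ {false} ab = inj₂ ab

ind-∧-false : ∀ {a b} → (a ≡ true → b ≡ true → ⊥) → ind (a ∧ b) ≡ 0ℚ
ind-∧-false {true}  {true}  ¬ab = ⊥-elim (¬ab refl refl)
ind-∧-false {true}  {false} ¬ab = refl
ind-∧-false {false}         ¬ab = refl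

ind-≤ : ∀ {a b} → (a ≡ true → b ≡ true) → ind a ≤ ind b
ind-≤ {false} {false} _   = ≤-refl
ind-≤ {false} {true}  _   = from-yes (0ℚ ≤? 1ℚ)
ind-≤ {true}  {true}  _   = ≤-refl
ind-≤ {true}  {false} a⇒b = contradiction (a⇒b refl) (λ ())

ind-gap≤1 : ∀ a b → ind a - ind b ≤ 1ℚ
ind-gap≤1 true  true  = from-yes (0ℚ ≤? 1ℚ)
ind-gap≤1 true  false = ≤-refl
ind-gap≤1 false true  = from-yes (- 1ℚ ≤? 1ℚ)
ind-gap≤1 false false = from-yes (0ℚ ≤? 1ℚ)

∑-ind≡count : ∀ {n} (P : Fin n → Bool) → ∑[ i < n ] ind (P i) ≡ ℕtoℚ (count P)
∑-ind≡count {zero} P = refl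
∑-ind≡count {suc n} P with P zero
... | true  = trans (cong (1ℚ +_) (∑-ind≡count (P ∘ suc))) (sym (ℕtoℚ-suc (count (P ∘ suc))))
... | false = trans (+-identityˡ _) (∑-ind≡count (P ∘ suc))

-- Matrices acting on vectors

module _ {n : ℕ} where

  infixr 7 _·_

  _·_ : Matrix n → Vector ℚ n → Vector ℚ n
  (M · f) i = ∑[ k < n ] (M i k * f k)

  ·-congʳ : ∀ (M : Matrix n) {f g : Vector ℚ n} → f ≗ g → M · f ≗ M · g
  ·-congʳ M f≗g i = sum-cong-≗ (λ k → cong (M i k *_) (f≗g k))

  ·-congˡ : ∀ (M N : Matrix n) (f : Vector ℚ n) i → (∀ k → M i k ≡ N i k) → (M · f) i ≡ (N · f) i
  ·-congˡ M N f i M≡N = sum-cong-≗ (λ k → cong (_* f k) (M≡N k))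

  ⊗-column : ∀ (A B : Matrix n) i j → (A ⊗ B) i j ≡ (A · (λ k → B k j)) i
  ⊗-column A B i j = Σℚ≡sum (λ k → A i k * B k j)

  ·-⊗ : ∀ (A B : Matrix n) f → A · (B · f) ≗ (A ⊗ B) · f
  ·-⊗ A B f i = begin
    ∑[ k < n ] (A i k * ∑[ m < n ] (B k m * f m))      ≡⟨ sum-cong-≗ (λ k → *-distribˡ-sum (A i k) (λ m → B k m * f m)) ⟩
    ∑[ k < n ] ∑[ m < n ] (A i k * (B k m * f m))      ≡⟨ ∑-comm (λ k m → A i k * (B k m * f m)) ⟩
    ∑[ m < n ] ∑[ k < n ] (A i k * (B k m * f m))      ≡⟨ sum-cong-≗ (λ m → sum-cong-≗ (λ k → sym (*-assoc (A i k) (B k m) (f m)))) ⟩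
    ∑[ m < n ] ∑[ k < n ] (A i k * B k m * f m)        ≡⟨ sum-cong-≗ (λ m → sym (*-distribʳ-sum (f m) (λ k → A i k * B k m))) ⟩
    ∑[ m < n ] ((A · (λ k → B k m)) i * f m)           ≡⟨ sum-cong-≗ (λ m → cong (_* f m) (sym (⊗-column A B i m))) ⟩
    ((A ⊗ B) · f) i                                    ∎
    where open ≡-Reasoning

  ⊗-assoc : ∀ (A B C : Matrix n) i j → ((A ⊗ B) ⊗ C) i j ≡ (A ⊗ (B ⊗ C)) i j
  ⊗-assoc A B C i j = begin
    ((A ⊗ B) ⊗ C) i j                 ≡⟨ ⊗-column (A ⊗ B) C i j ⟩
    ((A ⊗ B) · (λ k → C k j)) i       ≡⟨ ·-⊗ A B (λ k → C k j) i ⟨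
    (A · (B · (λ k → C k j))) i       ≡⟨ ·-congʳ A (λ k → sym (⊗-column B C k j)) i ⟩
    (A · (λ k → (B ⊗ C) k j)) i       ≡⟨ ⊗-column A (B ⊗ C) i j ⟨
    (A ⊗ (B ⊗ C)) i j                 ∎
    where open ≡-Reasoning

  transpose-⊗ : ∀ (A B : Matrix n) i j → transpose (A ⊗ B) i j ≡ (transpose B ⊗ transpose A) i j
  transpose-⊗ A B i j = begin
    (A ⊗ B) j i                           ≡⟨ ⊗-column A B j i ⟩
    ∑[ k < n ] (A j k * B k i)            ≡⟨ sum-cong-≗ (λ k → *-comm (A j k) (B k i)) ⟩
    ∑[ k < n ] (B k i * A j k)            ≡⟨ ⊗-column (transpose B) (transpose A) i j ⟨
    (transpose B ⊗ transpose A) i j       ∎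
    where open ≡-Reasoning

  ·-zero : ∀ (M : Matrix n) → M · (λ _ → 0ℚ) ≗ (λ _ → 0ℚ)
  ·-zero M i = trans (sum-cong-≗ (λ k → *-zeroʳ (M i k))) (sum-replicate-zero n)

  ·-+ : ∀ (M : Matrix n) f g → M · (λ k → f k + g k) ≗ (λ i → (M · f) i + (M · g) i)
  ·-+ M f g i = trans (sum-cong-≗ (λ k → *-distribˡ-+ (M i k) (f k) (g k))) (∑-distrib-+ (λ k → M i k * f k) (λ k → M i k * g k))

  ·-affine : ∀ (M : Matrix n) (a b : ℚ) f → M · (λ k → a * f k - b) ≗ (λ i → a * (M · f) i - b * (M · (λ _ → 1ℚ)) i)
  ·-affine M a b f i = begin
    ∑[ k < n ] (M i k * (a * f k - b))                       ≡⟨ sum-cong-≗ (λ k → distrib (M i k) (f k)) ⟩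
    ∑[ k < n ] (a * (M i k * f k) - b * (M i k * 1ℚ))        ≡⟨ ∑-distrib-- (λ k → a * (M i k * f k)) (λ k → b * (M i k * 1ℚ)) ⟩
    ∑[ k < n ] (a * (M i k * f k)) - ∑[ k < n ] (b * (M i k * 1ℚ))
                                                             ≡⟨ cong₂ _-_ (*-distribˡ-sum a (λ k → M i k * f k)) (*-distribˡ-sum b (λ k → M i k * 1ℚ)) ⟨
    a * (M · f) i - b * (M · (λ _ → 1ℚ)) i                   ∎
    where
    open ≡-Reasoning
    distrib : ∀ m x → m * (a * x - b) ≡ a * (m * x) - b * (m * 1ℚ)
    distrib m x = solve 4 (λ m x a b → m :* (a :* x :- b) := a :* (m :* x) :- b :* (m :* con 1ℚ)) refl m x a b

  ·-∑ : ∀ (M : Matrix n) (c : Vector ℚ n) (S : Fin n → Vector ℚ n) →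
        M · (λ k → ∑[ p < n ] (c p * S p k)) ≗ (λ i → ∑[ p < n ] (c p * (M · S p) i))
  ·-∑ M c S i = begin
    ∑[ k < n ] (M i k * ∑[ p < n ] (c p * S p k))      ≡⟨ sum-cong-≗ (λ k → *-distribˡ-sum (M i k) (λ p → c p * S p k)) ⟩
    ∑[ k < n ] ∑[ p < n ] (M i k * (c p * S p k))      ≡⟨ ∑-comm (λ k p → M i k * (c p * S p k)) ⟩
    ∑[ p < n ] ∑[ k < n ] (M i k * (c p * S p k))      ≡⟨ sum-cong-≗ (λ p → sum-cong-≗ (λ k → *-left-comm (M i k) (c p) (S p k))) ⟩
    ∑[ p < n ] ∑[ k < n ] (c p * (M i k * S p k))      ≡⟨ sum-cong-≗ (λ p → *-distribˡ-sum (c p) (λ k → M i k * S p k)) ⟨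
    ∑[ p < n ] (c p * (M · S p) i)                     ∎
    where
    open ≡-Reasoning
    *-left-comm : ∀ a b c → a * (b * c) ≡ b * (a * c)
    *-left-comm a b c = solve 3 (λ a b c → a :* (b :* c) := b :* (a :* c)) refl a b c

  ∑-*-δ-δ : ∀ (f : Vector ℚ n) p q → ∑[ k < n ] (f k * (δ p k - δ q k)) ≡ f p - f q
  ∑-*-δ-δ f p q = begin
    ∑[ k < n ] (f k * (δ p k - δ q k))                     ≡⟨ sum-cong-≗ (λ k → distrib (f k) (δ p k) (δ q k)) ⟩
    ∑[ k < n ] (δ p k * f k - δ q k * f k)                 ≡⟨ ∑-distrib-- (λ k → δ p k * f k) (λ k → δ q k * f k) ⟩
    ∑[ k < n ] (δ p k * f k) - ∑[ k < n ] (δ q k * f k)    ≡⟨ cong₂ _-_ (∑-δ* p f) (∑-δ* q f) ⟩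
    f p - f q                                              ∎
    where
    open ≡-Reasoning
    distrib : ∀ a b c → a * (b - c) ≡ b * a - c * a
    distrib a b c = solve 3 (λ a b c → a :* (b :- c) := b :* a :- c :* a) refl a b c

  ∑-*-δ-δ-mean-zero : ∀ (w : Vector ℚ n) o → sum w ≡ 0ℚ → ∀ v → ∑[ p < n ] (w p * (δ p v - δ o v)) ≡ w v
  ∑-*-δ-δ-mean-zero w o ∑w≡0 v = begin
    ∑[ p < n ] (w p * (δ p v - δ o v))                      ≡⟨ sum-cong-≗ (λ p → cong (λ t → w p * (t - δ o v)) (δ-sym p v)) ⟩
    ∑[ p < n ] (w p * (δ v p - δ o v))                      ≡⟨ sum-cong-≗ (λ p → distrib (w p) (δ v p) (δ o v)) ⟩
    ∑[ p < n ] (δ v p * w p - w p * δ o v)                  ≡⟨ ∑-distrib-- (λ p → δ v p * w p) (λ p → w p * δ o v) ⟩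
    ∑[ p < n ] (δ v p * w p) - ∑[ p < n ] (w p * δ o v)     ≡⟨ cong₂ _-_ (∑-δ* v w) (sym (*-distribʳ-sum (δ o v) w)) ⟩
    w v - sum w * δ o v                                     ≡⟨ cong (λ s → w v - s * δ o v) ∑w≡0 ⟩
    w v - 0ℚ * δ o v                                        ≡⟨ solve 2 (λ a b → a :- con 0ℚ :* b := a) refl (w v) (δ o v) ⟩
    w v                                                     ∎
    where
    open ≡-Reasoning
    distrib : ∀ a b c → a * (b - c) ≡ b * a - a * c
    distrib a b c = solve 3 (λ a b c → a :* (b :- c) := b :* a :- a :* c) refl a b c

  -- n·y − (Σ y)·1 has mean zero, so it is a combination of the vectors e_p − e_o and thus lies
  -- in the range of B; M fixes it and kills 1.
  projection : ∀ (M B : Matrix n) (o : Fin n) →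
               (∀ z → M · (B · z) ≗ B · z) → M · (λ _ → 1ℚ) ≗ (λ _ → 0ℚ) →
               (∀ p → ∃ λ z → B · z ≗ (λ v → δ p v - δ o v)) →
               ∀ y i → ℕtoℚ n * (M · y) i ≡ ℕtoℚ n * y i - sum y
  projection M B o M-fixes-B M-kills-1 B-spans y i = begin
    ℕtoℚ n * (M · y) i                                ≡⟨ solve 2 (λ a s → a := a :- s :* con 0ℚ) refl (ℕtoℚ n * (M · y) i) (sum y) ⟩
    ℕtoℚ n * (M · y) i - sum y * 0ℚ                   ≡⟨ cong (λ t → ℕtoℚ n * (M · y) i - sum y * t) (M-kills-1 i) ⟨
    ℕtoℚ n * (M · y) i - sum y * (M · (λ _ → 1ℚ)) i   ≡⟨ ·-affine M (ℕtoℚ n) (sum y) y i ⟨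
    (M · w) i                                         ≡⟨ ·-congʳ M (λ k → sym (B·s≡w k)) i ⟩
    (M · (B · s)) i                                   ≡⟨ M-fixes-B s i ⟩
    (B · s) i                                         ≡⟨ B·s≡w i ⟩
    w i                                               ∎
    where
    open ≡-Reasoning
    w : Vector ℚ n
    w k = ℕtoℚ n * y k - sum y
    ∑w≡0 : sum w ≡ 0ℚ
    ∑w≡0 = begin
      sum w                                              ≡⟨ ∑-distrib-- (λ k → ℕtoℚ n * y k) (λ _ → sum y) ⟩
      ∑[ k < n ] (ℕtoℚ n * y k) - ∑[ k < n ] sum y       ≡⟨ cong₂ _-_ (sym (*-distribˡ-sum (ℕtoℚ n) y)) (sum-const n (sum y)) ⟩
      ℕtoℚ n * sum y - ℕtoℚ n * sum y                    ≡⟨ +-inverseʳ (ℕtoℚ n * sum y) ⟩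
      0ℚ                                                 ∎
    s : Vector ℚ n
    s k = ∑[ p < n ] (w p * proj₁ (B-spans p) k)
    B·s≡w : B · s ≗ w
    B·s≡w v = begin
      (B · s) v                                          ≡⟨ ·-∑ B w (λ p → proj₁ (B-spans p)) v ⟩
      ∑[ p < n ] (w p * (B · proj₁ (B-spans p)) v)       ≡⟨ sum-cong-≗ (λ p → cong (w p *_) (proj₂ (B-spans p) v)) ⟩
      ∑[ p < n ] (w p * (δ p v - δ o v))                 ≡⟨ ∑-*-δ-δ-mean-zero w o ∑w≡0 v ⟩
      w v                                                ∎

-- Potentials and the Moore–Penrose inverse

record Potentials {n} (A : Matrix n) (p q : Fin n) (d : ℚ) : Set where
  field
    y z    : Vector ℚ n
    A·y≡δ  : A · y ≗ (λ v → δ p v - δ q v)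
    Aᵀ·z≡δ : transpose A · z ≗ (λ v → δ p v - δ q v)
    z≤y    : ∀ v → z v ≤ y v
    gap≤   : ∀ v w → y v - z w ≤ d

module _ {n} {A : Matrix n} where

  Potentials-refl : ∀ {p} → Potentials A p p 0ℚ
  Potentials-refl {p} = record
    { y = λ _ → 0ℚ ; z = λ _ → 0ℚ
    ; A·y≡δ  = λ v → trans (·-zero A v) (sym (+-inverseʳ (δ p v)))
    ; Aᵀ·z≡δ = λ v → trans (·-zero (transpose A) v) (sym (+-inverseʳ (δ p v)))
    ; z≤y    = λ _ → ≤-refl
    ; gap≤   = λ _ _ → ≤-refl
    }

  Potentials-trans : ∀ {p m q a b} → Potentials A p m a → Potentials A m q b → Potentials A p q (a + b)
  Potentials-trans {p} {m} {q} {a} {b} P Q = record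
    { y = λ v → y₁ v + y₂ v ; z = λ v → z₁ v + z₂ v
    ; A·y≡δ  = λ v → trans (·-+ A y₁ y₂ v) (trans (cong₂ _+_ (P.A·y≡δ v) (Q.A·y≡δ v)) (telescope (δ p v) (δ m v) (δ q v)))
    ; Aᵀ·z≡δ = λ v → trans (·-+ (transpose A) z₁ z₂ v) (trans (cong₂ _+_ (P.Aᵀ·z≡δ v) (Q.Aᵀ·z≡δ v)) (telescope (δ p v) (δ m v) (δ q v)))
    ; z≤y    = λ v → +-mono-≤ (P.z≤y v) (Q.z≤y v)
    ; gap≤   = λ v w → ≤-trans (≤-reflexive (interchange (y₁ v) (y₂ v) (z₁ w) (z₂ w))) (+-mono-≤ (P.gap≤ v w) (Q.gap≤ v w))
    }
    where
    module P = Potentials P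
    module Q = Potentials Q
    open P using () renaming (y to y₁; z to z₁)
    open Q using () renaming (y to y₂; z to z₂)
    telescope : ∀ r s t → (r - s) + (s - t) ≡ r - t
    telescope r s t = solve 3 (λ r s t → (r :- s) :+ (s :- t) := r :- t) refl r s t
    interchange : ∀ r s t u → (r + s) - (t + u) ≡ (r - t) + (s - u)
    interchange r s t u = solve 4 (λ r s t u → (r :+ s) :- (t :+ u) := (r :- t) :+ (s :- u)) refl r s t u

module MoorePenrose {n} {A X : Matrix n} (mp : IsMoorePenrose A X) where

  private
    AXA≡A : ∀ i j → ((A ⊗ X) ⊗ A) i j ≡ A i j
    AXA≡A = proj₁ mp
    AX-symm : ∀ i j → (A ⊗ X) j i ≡ (A ⊗ X) i j
    AX-symm = proj₁ (proj₂ (proj₂ mp))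
    XA-symm : ∀ i j → (X ⊗ A) j i ≡ (X ⊗ A) i j
    XA-symm = proj₂ (proj₂ (proj₂ mp))

  XA-fixes-range-Aᵀ : ∀ z → (X ⊗ A) · (transpose A · z) ≗ transpose A · z
  XA-fixes-range-Aᵀ z i = trans (·-⊗ (X ⊗ A) (transpose A) z i) (·-congˡ ((X ⊗ A) ⊗ transpose A) (transpose A) z i entry)
    where
    open ≡-Reasoning
    entry : ∀ k → ((X ⊗ A) ⊗ transpose A) i k ≡ A k i
    entry k = begin
      ((X ⊗ A) ⊗ transpose A) i k        ≡⟨ ⊗-column (X ⊗ A) (transpose A) i k ⟩
      ∑[ m < n ] ((X ⊗ A) i m * A k m)   ≡⟨ sum-cong-≗ (λ m → trans (cong (_* A k m) (XA-symm m i)) (*-comm ((X ⊗ A) m i) (A k m))) ⟩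
      ∑[ m < n ] (A k m * (X ⊗ A) m i)   ≡⟨ ⊗-column A (X ⊗ A) k i ⟨
      (A ⊗ (X ⊗ A)) k i                  ≡⟨ ⊗-assoc A X A k i ⟨
      ((A ⊗ X) ⊗ A) k i                  ≡⟨ AXA≡A k i ⟩
      A k i                              ∎

  AX-fixes-range-A : ∀ z → (A ⊗ X) · (A · z) ≗ A · z
  AX-fixes-range-A z j = trans (·-⊗ (A ⊗ X) A z j) (·-congˡ ((A ⊗ X) ⊗ A) A z j (AXA≡A j))

  XA-kills-ker-A : ∀ y → A · y ≗ (λ _ → 0ℚ) → (X ⊗ A) · y ≗ (λ _ → 0ℚ)
  XA-kills-ker-A y A·y≡0 i = begin
    ((X ⊗ A) · y) i              ≡⟨ ·-⊗ X A y i ⟨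
    (X · (A · y)) i              ≡⟨ ·-congʳ X A·y≡0 i ⟩
    (X · (λ _ → 0ℚ)) i           ≡⟨ ·-zero X i ⟩
    0ℚ                           ∎
    where open ≡-Reasoning

  AX·≡Xᵀ·Aᵀ· : ∀ z → (A ⊗ X) · z ≗ transpose X · (transpose A · z)
  AX·≡Xᵀ·Aᵀ· z j = begin
    ((A ⊗ X) · z) j                          ≡⟨ ·-congˡ (transpose X ⊗ transpose A) (A ⊗ X) z j (λ m → trans (sym (transpose-⊗ A X j m)) (AX-symm j m)) ⟨
    ((transpose X ⊗ transpose A) · z) j      ≡⟨ ·-⊗ (transpose X) (transpose A) z j ⟨
    (transpose X · (transpose A · z)) j      ∎
    where open ≡-Reasoning

  AX-kills-ker-Aᵀ : ∀ z → transpose A · z ≗ (λ _ → 0ℚ) → (A ⊗ X) · z ≗ (λ _ → 0ℚ)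
  AX-kills-ker-Aᵀ z Aᵀ·z≡0 j = begin
    ((A ⊗ X) · z) j                       ≡⟨ AX·≡Xᵀ·Aᵀ· z j ⟩
    (transpose X · (transpose A · z)) j   ≡⟨ ·-congʳ (transpose X) Aᵀ·z≡0 j ⟩
    (transpose X · (λ _ → 0ℚ)) j          ≡⟨ ·-zero (transpose X) j ⟩
    0ℚ                                    ∎
    where open ≡-Reasoning

  resistance-via-potentials : ∀ {i j} y z →
    A · y ≗ (λ v → δ i v - δ j v) → transpose A · z ≗ (λ v → δ i v - δ j v) →
    resistance X i j ≡ ((X ⊗ A) · y) i - ((A ⊗ X) · z) j
  resistance-via-potentials {i} {j} y z A·y≡δ Aᵀ·z≡δ = begin
    (X i i + X j j) - ℕtoℚ 2 * X i j      ≡⟨ solve 3 (λ a b c → (a :+ c) :- (con 1ℚ :+ con 1ℚ) :* b := (a :- b) :- (b :- c)) refl (X i i) (X i j) (X j j) ⟩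
    (X i i - X i j) - (X i j - X j j)     ≡⟨ cong₂ _-_ XA·y≡ AX·z≡ ⟨
    ((X ⊗ A) · y) i - ((A ⊗ X) · z) j     ∎
    where
    open ≡-Reasoning
    XA·y≡ : ((X ⊗ A) · y) i ≡ X i i - X i j
    XA·y≡ = begin
      ((X ⊗ A) · y) i                            ≡⟨ ·-⊗ X A y i ⟨
      (X · (A · y)) i                            ≡⟨ ·-congʳ X A·y≡δ i ⟩
      ∑[ k < n ] (X i k * (δ i k - δ j k))       ≡⟨ ∑-*-δ-δ (X i) i j ⟩
      X i i - X i j                              ∎
    AX·z≡ : ((A ⊗ X) · z) j ≡ X i j - X j j
    AX·z≡ = begin
      ((A ⊗ X) · z) j                            ≡⟨ AX·≡Xᵀ·Aᵀ· z j ⟩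
      (transpose X · (transpose A · z)) j        ≡⟨ ·-congʳ (transpose X) Aᵀ·z≡δ j ⟩
      ∑[ k < n ] (X k j * (δ i k - δ j k))       ≡⟨ ∑-*-δ-δ (λ k → X k j) i j ⟩
      X i j - X j j                              ∎

  resistance-bound : ∀ (o : Fin n) → A · (λ _ → 1ℚ) ≗ (λ _ → 0ℚ) → transpose A · (λ _ → 1ℚ) ≗ (λ _ → 0ℚ) →
                     (∀ p → ∃ λ d → Potentials A p o d) →
                     ∀ {i j d} → Potentials A i j d → ℕtoℚ n * resistance X i j ≤ ℕtoℚ n * d
  resistance-bound o A·1≡0 Aᵀ·1≡0 spans {i} {j} {d} P = begin
    N * resistance X i j                               ≡⟨ cong (N *_) (resistance-via-potentials y z A·y≡δ Aᵀ·z≡δ) ⟩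
    N * (((X ⊗ A) · y) i - ((A ⊗ X) · z) j)            ≡⟨ solve 3 (λ N a b → N :* (a :- b) := N :* a :- N :* b) refl N _ _ ⟩
    N * ((X ⊗ A) · y) i - N * ((A ⊗ X) · z) j          ≡⟨ cong₂ _-_ XA-projects AX-projects ⟩
    (N * y i - sum y) - (N * z j - sum z)              ≡⟨ solve 5 (λ N a b s t → (N :* a :- s) :- (N :* b :- t) := N :* (a :- b) :+ (t :- s)) refl N (y i) (z j) (sum y) (sum z) ⟩
    N * (y i - z j) + (sum z - sum y)                  ≤⟨ +-mono-≤ (*-monoˡ-≤-nonNeg N (gap≤ i j)) (+-monoˡ-≤ (- sum y) (sum-mono-≤ z≤y)) ⟩
    N * d + (sum y - sum y)                            ≡⟨ cong (N * d +_) (+-inverseʳ (sum y)) ⟩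
    N * d + 0ℚ                                         ≡⟨ +-identityʳ (N * d) ⟩
    N * d                                              ∎
    where
    open ≤-Reasoning
    open Potentials P
    N : ℚ
    N = ℕtoℚ n
    instance
      N-nonNeg : NonNegative N
      N-nonNeg = normalize-nonNeg n 1
    A-spans : ∀ p → ∃ λ y → A · y ≗ (λ v → δ p v - δ o v)
    A-spans p = let _ , Pₚ = spans p in Potentials.y Pₚ , Potentials.A·y≡δ Pₚ
    Aᵀ-spans : ∀ p → ∃ λ z → transpose A · z ≗ (λ v → δ p v - δ o v)
    Aᵀ-spans p = let _ , Pₚ = spans p in Potentials.z Pₚ , Potentials.Aᵀ·z≡δ Pₚ
    XA-projects : N * ((X ⊗ A) · y) i ≡ N * y i - sum y
    XA-projects = projection (X ⊗ A) (transpose A) o XA-fixes-range-Aᵀ (XA-kills-ker-A (λ _ → 1ℚ) A·1≡0) Aᵀ-spans y i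
    AX-projects : N * ((A ⊗ X) · z) j ≡ N * z j - sum z
    AX-projects = projection (A ⊗ X) A o AX-fixes-range-A (AX-kills-ker-Aᵀ (λ _ → 1ℚ) Aᵀ·1≡0) A-spans z j

-- Laplacians

reverse : ∀ {n} → Digraph n → Digraph n
reverse E i j = E j i

record UniqueCrossing {n} (E : Digraph n) (P Q : Fin n → Bool) (s t : Fin n) : Set where
  field
    edge   : E s t ≡ true
    source : P s ≡ true
    target : Q t ≡ true
    unique : ∀ {v w} → E v w ≡ true → P v ≡ true → Q w ≡ true → v ≡ s × w ≡ t

UniqueCrossing-reverse : ∀ {n} {E : Digraph n} {P Q s t} → UniqueCrossing E P Q s t → UniqueCrossing (reverse E) Q P t s
UniqueCrossing-reverse c = record
  { edge = edge ; source = target ; target = source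
  ; unique = λ e qv pw → let w≡s , v≡t = unique e pw qv in v≡t , w≡s }
  where open UniqueCrossing c

UniqueCrossing-cong : ∀ {n} {E : Digraph n} {P P′ Q Q′ s t} → P ≗ P′ → Q ≗ Q′ →
                      UniqueCrossing E P Q s t → UniqueCrossing E P′ Q′ s t
UniqueCrossing-cong P≗P′ Q≗Q′ c = record
  { edge = edge ; source = trans (sym (P≗P′ _)) source ; target = trans (sym (Q≗Q′ _)) target
  ; unique = λ e P′v Q′w → unique e (trans (P≗P′ _) P′v) (trans (Q≗Q′ _) Q′w) }
  where open UniqueCrossing c

module _ {n} (E : Digraph n) where

  ∑-crossing : ∀ {P Q s t} → UniqueCrossing E P Q s t → ∀ v → P v ≡ true → ∑[ w < n ] ind (E v w ∧ Q w) ≡ δ s v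
  ∑-crossing {Q = Q} {s} {t} c v Pv with v ≟ s
  ... | yes refl = begin
    ∑[ w < n ] ind (E v w ∧ Q w)   ≡⟨ sum-single (λ w → ind (E v w ∧ Q w)) t (λ w w≢t → ind-∧-false (λ e Qw → w≢t (proj₂ (unique e Pv Qw)))) ⟩
    ind (E v t ∧ Q t)              ≡⟨ cong₂ (λ a b → ind (a ∧ b)) edge target ⟩
    1ℚ                             ≡⟨ δ-diag v ⟨
    δ v v                          ∎
    where
    open ≡-Reasoning
    open UniqueCrossing c
  ... | no v≢s = begin
    ∑[ w < n ] ind (E v w ∧ Q w)   ≡⟨ sum-cong-≗ {n} (λ w → ind-∧-false (λ e Qw → v≢s (proj₁ (UniqueCrossing.unique c e Pv Qw)))) ⟩
    ∑[ w < n ] 0ℚ                  ≡⟨ sum-replicate-zero n ⟩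
    0ℚ                             ≡⟨ δ-off (v≢s ∘ sym) ⟨
    δ s v                          ∎
    where open ≡-Reasoning

  laplacian-entry : Simple E → ∀ v w (f : Vector ℚ n) →
                    laplacian E v w * f w ≡ δ v w * (ℕtoℚ (outdeg E v) * f v) - ind (E v w) * f w
  laplacian-entry simple v w f with v ≟ w
  ... | yes refl rewrite simple v = solve 2 (λ d x → d :* x := con 1ℚ :* (d :* x) :- con 0ℚ :* x) refl (ℕtoℚ (outdeg E v)) (f v)
  ... | no _ with E v w
  ...   | true  = solve 2 (λ d x → (:- con 1ℚ) :* x := con 0ℚ :* d :- con 1ℚ :* x) refl (ℕtoℚ (outdeg E v) * f v) (f w)
  ...   | false = solve 2 (λ d x → con 0ℚ :* x := con 0ℚ :* d :- con 0ℚ :* x) refl (ℕtoℚ (outdeg E v) * f v) (f w)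

  laplacian-row : Simple E → ∀ f v → (laplacian E · f) v ≡ ∑[ w < n ] (ind (E v w) * (f v - f w))
  laplacian-row simple f v = begin
    (laplacian E · f) v                                                      ≡⟨ sum-cong-≗ (λ w → laplacian-entry simple v w f) ⟩
    ∑[ w < n ] (δ v w * (ℕtoℚ (outdeg E v) * f v) - ind (E v w) * f w)       ≡⟨ ∑-distrib-- (λ w → δ v w * (ℕtoℚ (outdeg E v) * f v)) (λ w → ind (E v w) * f w) ⟩
    ∑[ w < n ] (δ v w * (ℕtoℚ (outdeg E v) * f v)) - ∑[ w < n ] (ind (E v w) * f w)
                                                                             ≡⟨ cong (_- ∑[ w < n ] (ind (E v w) * f w)) (∑-δ* v (λ _ → ℕtoℚ (outdeg E v) * f v)) ⟩
    ℕtoℚ (outdeg E v) * f v - ∑[ w < n ] (ind (E v w) * f w)                 ≡⟨ cong (λ d → d * f v - ∑[ w < n ] (ind (E v w) * f w)) (∑-ind≡count (E v)) ⟨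
    ∑[ w < n ] ind (E v w) * f v - ∑[ w < n ] (ind (E v w) * f w)            ≡⟨ cong (_- ∑[ w < n ] (ind (E v w) * f w)) (*-distribʳ-sum (f v) (ind ∘ E v)) ⟩
    ∑[ w < n ] (ind (E v w) * f v) - ∑[ w < n ] (ind (E v w) * f w)          ≡⟨ ∑-distrib-- (λ w → ind (E v w) * f v) (λ w → ind (E v w) * f w) ⟨
    ∑[ w < n ] (ind (E v w) * f v - ind (E v w) * f w)                       ≡⟨ sum-cong-≗ (λ w → sym (*-distribˡ-- (ind (E v w)) (f v) (f w))) ⟩
    ∑[ w < n ] (ind (E v w) * (f v - f w))                                   ∎
    where
    open ≡-Reasoning
    *-distribˡ-- : ∀ a b c → a * (b - c) ≡ a * b - a * c
    *-distribˡ-- a b c = solve 3 (λ a b c → a :* (b :- c) := a :* b :- a :* c) refl a b c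

  laplacian-const : Simple E → ∀ c → laplacian E · (λ _ → c) ≗ (λ _ → 0ℚ)
  laplacian-const simple c v = begin
    (laplacian E · (λ _ → c)) v           ≡⟨ laplacian-row simple (λ _ → c) v ⟩
    ∑[ w < n ] (ind (E v w) * (c - c))    ≡⟨ sum-cong-≗ (λ w → trans (cong (ind (E v w) *_) (+-inverseʳ c)) (*-zeroʳ (ind (E v w)))) ⟩
    ∑[ w < n ] 0ℚ                         ≡⟨ sum-replicate-zero n ⟩
    0ℚ                                    ∎
    where open ≡-Reasoning

  transpose-laplacian : (∀ v → outdeg E v ≡ outdeg (reverse E) v) →
                        ∀ i j → transpose (laplacian E) i j ≡ laplacian (reverse E) i j
  transpose-laplacian balanced i j with j ≟ i | i ≟ j
  ... | yes refl | yes _   = cong ℕtoℚ (balanced i)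
  ... | no _     | no _    = refl
  ... | yes j≡i  | no i≢j  = contradiction (sym j≡i) i≢j
  ... | no j≢i   | yes i≡j = contradiction (sym i≡j) j≢i

  laplacian-indicator : Simple E → ∀ {S s s′ r r′} →
    UniqueCrossing E S (not ∘ S) s s′ → UniqueCrossing E (not ∘ S) S r r′ →
    laplacian E · (ind ∘ S) ≗ (λ v → δ s v - δ r v)
  laplacian-indicator simple {S} {s} {_} {r} out into v with S v in Sv
  ... | true = begin
    (laplacian E · (ind ∘ S)) v                  ≡⟨ laplacian-row simple (ind ∘ S) v ⟩
    ∑[ w < n ] (ind (E v w) * (ind (S v) - ind (S w)))   ≡⟨ sum-cong-≗ (λ w → cong (λ b → ind (E v w) * (ind b - ind (S w))) Sv) ⟩
    ∑[ w < n ] (ind (E v w) * (1ℚ - ind (S w)))  ≡⟨ sum-cong-≗ (λ w → leaving (E v w) (S w)) ⟩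
    ∑[ w < n ] ind (E v w ∧ not (S w))           ≡⟨ ∑-crossing out v Sv ⟩
    δ s v                                        ≡⟨ +-identityʳ (δ s v) ⟨
    δ s v - 0ℚ                                   ≡⟨ cong (λ t → δ s v - t) (δ-off r≢v) ⟨
    δ s v - δ r v                                ∎
    where
    open ≡-Reasoning
    leaving : ∀ a b → ind a * (1ℚ - ind b) ≡ ind (a ∧ not b)
    leaving true true = refl
    leaving true false = refl
    leaving false true = refl
    leaving false false = refl
    r≢v : r ≢ v
    r≢v refl with trans (sym (UniqueCrossing.source into)) (cong not Sv)
    ... | ()
  ... | false = begin
    (laplacian E · (ind ∘ S)) v                  ≡⟨ laplacian-row simple (ind ∘ S) v ⟩
    ∑[ w < n ] (ind (E v w) * (ind (S v) - ind (S w)))   ≡⟨ sum-cong-≗ (λ w → cong (λ b → ind (E v w) * (ind b - ind (S w))) Sv) ⟩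
    ∑[ w < n ] (ind (E v w) * (0ℚ - ind (S w)))  ≡⟨ sum-cong-≗ (λ w → entering (E v w) (S w)) ⟩
    ∑[ w < n ] (- ind (E v w ∧ S w))             ≡⟨ ∑-neg (λ w → ind (E v w ∧ S w)) ⟩
    - ∑[ w < n ] ind (E v w ∧ S w)               ≡⟨ cong -_ (∑-crossing into v (cong not Sv)) ⟩
    - δ r v                                      ≡⟨ +-identityˡ (- δ r v) ⟨
    0ℚ - δ r v                                   ≡⟨ cong (_- δ r v) (δ-off s≢v) ⟨
    δ s v - δ r v                                ∎
    where
    open ≡-Reasoning
    entering : ∀ a b → ind a * (0ℚ - ind b) ≡ - ind (a ∧ b)
    entering true true = refl
    entering true false = refl
    entering false true = refl
    entering false false = refl
    s≢v : s ≢ v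
    s≢v refl with trans (sym (UniqueCrossing.source out)) Sv
    ... | ()


-- Lists, cycles and paths

firstOr : ∀ {A : Set} → A → List A → A
firstOr y []      = y
firstOr y (m ∷ _) = m

module _ {A : Set} where

  Unique-∷⇒∉ : ∀ {x : A} {xs} → Unique (x ∷ xs) → x ∉ xs
  Unique-∷⇒∉ (x≢xs ∷ _) x∈xs = All.lookup x≢xs x∈xs refl

  ∉⇒Unique-∷ : ∀ {x : A} {xs} → x ∉ xs → Unique xs → Unique (x ∷ xs)
  ∉⇒Unique-∷ {xs = xs} x∉xs u = All.tabulate (λ y∈xs x≡y → x∉xs (subst (_∈ xs) (sym x≡y) y∈xs)) ∷ u

  Unique-++⁻ʳ : ∀ (xs : List A) {ys} → Unique (xs ++ ys) → Unique ys
  Unique-++⁻ʳ []       u       = u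
  Unique-++⁻ʳ (x ∷ xs) (_ ∷ u) = Unique-++⁻ʳ xs u

  Unique-resp-↭ : ∀ {xs ys : List A} → xs ↭ ys → Unique xs → Unique ys
  Unique-resp-↭ p = ↭ₛ.Unique-resp-↭ (setoid A) (↭⇒↭ₛ p)

  Unique-splice : ∀ {x y : A} B D ms → Unique (x ∷ B ++ y ∷ D) → Unique ms →
                  (∀ {m} → m ∈ ms → m ∉ x ∷ B ++ y ∷ D) → Unique (x ∷ ms ++ y ∷ D)
  Unique-splice {x} {y} B D ms u ms-unique ms∩xByD=∅ =
    ∉⇒Unique-∷ x∉ (Unique.++⁺ ms-unique (Unique-++⁻ʳ (x ∷ B) u) (λ (m∈ms , m∈yD) → ms∩xByD=∅ m∈ms (∈-++⁺ʳ (x ∷ B) m∈yD)))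
    where
    x∉ : x ∉ ms ++ y ∷ D
    x∉ x∈ with ∈-++⁻ ms x∈
    ... | inj₁ x∈ms = ms∩xByD=∅ x∈ms (here refl)
    ... | inj₂ x∈yD = Unique-∷⇒∉ u (∈-++⁺ʳ B x∈yD)

  length-≤-injection : ∀ {B : Set} (xs : List A) ys (f : ∀ {x} → x ∈ xs → B) → Unique xs →
                       (∀ {x} (x∈ : x ∈ xs) → f x∈ ∈ ys) →
                       (∀ {x y} (x∈ : x ∈ xs) (y∈ : y ∈ xs) → f x∈ ≡ f y∈ → x ≡ y) →
                       length xs ℕ.≤ length ys
  length-≤-injection []       ys f u          maps inj = z≤n
  length-≤-injection (x ∷ xs) ys f (x∉xs ∷ u) maps inj with ∈-∃++ (maps (here refl))
  ... | P , Q , eq = subst (suc (length xs) ℕ.≤_) (sym length-ys)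
                       (s≤s (length-≤-injection xs (P ++ Q) (f ∘ there) u maps′ (λ v w → inj (there v) (there w))))
    where
    length-ys : length ys ≡ suc (length (P ++ Q))
    length-ys = trans (cong length eq) (trans (length-++ P) (trans (ℕ.+-suc (length P) (length Q)) (cong suc (sym (length-++ P)))))
    maps′ : ∀ {w} (w∈ : w ∈ xs) → f (there w∈) ∈ P ++ Q
    maps′ w∈ with ∈-++⁻ P (subst (f (there w∈) ∈_) eq (maps (there w∈)))
    ... | inj₁ fw∈P         = ∈-++⁺ˡ fw∈P
    ... | inj₂ (here fw≡fx) = contradiction (inj (here refl) (there w∈) (sym fw≡fx)) (All.lookup x∉xs w∈)
    ... | inj₂ (there fw∈Q) = ∈-++⁺ʳ P fw∈Q

  consec-++ : ∀ (P : List A) z Q → consec (P ++ z ∷ Q) ≡ consec (P ++ [ z ]) ++ consec (z ∷ Q)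
  consec-++ []          z Q = refl
  consec-++ (a ∷ [])    z Q = refl
  consec-++ (a ∷ b ∷ P) z Q = cong ((a , b) ∷_) (consec-++ (b ∷ P) z Q)

  consec-∈ʳ : ∀ {a b : A} x L → (a , b) ∈ consec (x ∷ L) → b ∈ L
  consec-∈ʳ x (y ∷ L) (here refl) = here refl
  consec-∈ʳ x (y ∷ L) (there ab∈) = there (consec-∈ʳ y L ab∈)

  consec-∈ˡ-∷ʳ : ∀ {a b : A} L z → (a , b) ∈ consec (L ++ [ z ]) → a ∈ L
  consec-∈ˡ-∷ʳ (x ∷ [])    z (here refl) = here refl
  consec-∈ˡ-∷ʳ (x ∷ y ∷ L) z (here refl) = here refl
  consec-∈ˡ-∷ʳ (x ∷ y ∷ L) z (there ab∈) = there (consec-∈ˡ-∷ʳ (y ∷ L) z ab∈)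

  consec-succ : ∀ {a : A} L z → a ∈ L → ∃ λ b → (a , b) ∈ consec (L ++ [ z ])
  consec-succ (x ∷ [])    z (here refl) = z , here refl
  consec-succ (x ∷ y ∷ L) z (here refl) = y , here refl
  consec-succ (x ∷ y ∷ L) z (there a∈)  = let b , ab∈ = consec-succ (y ∷ L) z a∈ in b , there ab∈

  consec-pred : ∀ {b : A} x L → b ∈ L → ∃ λ a → (a , b) ∈ consec (x ∷ L)
  consec-pred x (y ∷ L) (here refl) = x , here refl
  consec-pred x (y ∷ L) (there b∈)  = let a , ab∈ = consec-pred y L b∈ in a , there ab∈

  consec-succ-unique : ∀ {a b b′ : A} L z → Unique L →
                       (a , b) ∈ consec (L ++ [ z ]) → (a , b′) ∈ consec (L ++ [ z ]) → b ≡ b′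
  consec-succ-unique (x ∷ [])    z u       (here refl) (here refl) = refl
  consec-succ-unique (x ∷ y ∷ L) z u       (here refl) (here refl) = refl
  consec-succ-unique (x ∷ y ∷ L) z u       (here refl) (there ab∈) = contradiction (consec-∈ˡ-∷ʳ (y ∷ L) z ab∈) (Unique-∷⇒∉ u)
  consec-succ-unique (x ∷ y ∷ L) z u       (there ab∈) (here refl) = contradiction (consec-∈ˡ-∷ʳ (y ∷ L) z ab∈) (Unique-∷⇒∉ u)
  consec-succ-unique (x ∷ y ∷ L) z (_ ∷ u) (there ab∈) (there ab′∈) = consec-succ-unique (y ∷ L) z u ab∈ ab′∈

  consec-pred-unique : ∀ {a a′ b : A} x L → Unique L →
                       (a , b) ∈ consec (x ∷ L) → (a′ , b) ∈ consec (x ∷ L) → a ≡ a′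
  consec-pred-unique x (y ∷ L) u       (here refl) (here refl) = refl
  consec-pred-unique x (y ∷ L) u       (here refl) (there ab∈) = contradiction (consec-∈ʳ y L ab∈) (Unique-∷⇒∉ u)
  consec-pred-unique x (y ∷ L) u       (there ab∈) (here refl) = contradiction (consec-∈ʳ y L ab∈) (Unique-∷⇒∉ u)
  consec-pred-unique x (y ∷ L) (_ ∷ u) (there ab∈) (there a′b∈) = consec-pred-unique y L u ab∈ a′b∈

  consec-first : ∀ (x : A) L z → (x , firstOr z L) ∈ consec (x ∷ L ++ [ z ])
  consec-first x []      z = here refl
  consec-first x (m ∷ L) z = here refl

  cycleEdges-∈ˡ : ∀ {a b : A} C → (a , b) ∈ cycleEdges C → a ∈ C
  cycleEdges-∈ˡ (h ∷ t) = consec-∈ˡ-∷ʳ (h ∷ t) h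

  cycleEdges-∈ʳ : ∀ {a b : A} C → (a , b) ∈ cycleEdges C → b ∈ C
  cycleEdges-∈ʳ (h ∷ t) ab∈ = ∈-resp-↭ (++-comm t [ h ]) (consec-∈ʳ h (t ++ [ h ]) ab∈)

  cycleEdges-succ : ∀ {a : A} C → a ∈ C → ∃ λ b → (a , b) ∈ cycleEdges C
  cycleEdges-succ (h ∷ t) = consec-succ (h ∷ t) h

  cycleEdges-pred : ∀ {b : A} C → b ∈ C → ∃ λ a → (a , b) ∈ cycleEdges C
  cycleEdges-pred (h ∷ t) b∈ = consec-pred h (t ++ [ h ]) (∈-resp-↭ (++-comm [ h ] t) b∈)

  cycleEdges-succ-unique : ∀ {a b b′ : A} C → Unique C → (a , b) ∈ cycleEdges C → (a , b′) ∈ cycleEdges C → b ≡ b′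
  cycleEdges-succ-unique (h ∷ t) u = consec-succ-unique (h ∷ t) h u

  cycleEdges-pred-unique : ∀ {a a′ b : A} C → Unique C → (a , b) ∈ cycleEdges C → (a′ , b) ∈ cycleEdges C → a ≡ a′
  cycleEdges-pred-unique (h ∷ t) u = consec-pred-unique h (t ++ [ h ]) (Unique-resp-↭ (++-comm [ h ] t) u)

  cycleEdges-split : ∀ (a : A) P x Q → cycleEdges (a ∷ P ++ x ∷ Q) ≡ consec (a ∷ P ++ [ x ]) ++ consec (x ∷ Q ++ [ a ])
  cycleEdges-split a P x Q = trans (cong (λ L → consec (a ∷ L)) (++-assoc P (x ∷ Q) [ a ])) (consec-++ (a ∷ P) x (Q ++ [ a ]))

  arc⊆cycleEdgesˡ : ∀ (a : A) P x Q → consec (a ∷ P ++ [ x ]) ⊆ cycleEdges (a ∷ P ++ x ∷ Q)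
  arc⊆cycleEdgesˡ a P x Q e∈ = subst (_ ∈_) (sym (cycleEdges-split a P x Q)) (∈-++⁺ˡ e∈)

  arc⊆cycleEdgesʳ : ∀ (a : A) P x Q → consec (x ∷ Q ++ [ a ]) ⊆ cycleEdges (a ∷ P ++ x ∷ Q)
  arc⊆cycleEdgesʳ a P x Q e∈ = subst (_ ∈_) (sym (cycleEdges-split a P x Q)) (∈-++⁺ʳ (consec (a ∷ P ++ [ x ])) e∈)

  cycleEdges-rotate : ∀ P (x : A) Q → cycleEdges (x ∷ Q ++ P) ⊆ cycleEdges (P ++ x ∷ Q)
  cycleEdges-rotate []      x Q rewrite ++-identityʳ Q = id
  cycleEdges-rotate (a ∷ P) x Q e∈ rewrite cycleEdges-split x Q a P | cycleEdges-split a P x Q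
    with ∈-++⁻ (consec (x ∷ Q ++ [ a ])) e∈
  ... | inj₁ e∈xQa = ∈-++⁺ʳ (consec (a ∷ P ++ [ x ])) e∈xQa
  ... | inj₂ e∈aPx = ∈-++⁺ˡ e∈aPx

  rotate : ∀ {x : A} C → x ∈ C → ∃ λ R → C ↭ x ∷ R × cycleEdges (x ∷ R) ⊆ cycleEdges C
  rotate C x∈C with ∈-∃++ x∈C
  ... | P , Q , refl = Q ++ P , ++-comm P (_ ∷ Q) , cycleEdges-rotate P _ Q

Path : ∀ {A : Set} → (A → A → Set) → A → List A → A → Set
Path R x ms y = All (uncurry R) (consec (x ∷ ms ++ [ y ]))

module _ {A : Set} {R : A → A → Set} where

  path-split : ∀ {x y : A} P m Q → Path R x (P ++ m ∷ Q) y → Path R x P m × Path R m Q y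
  path-split {x} {y} P m Q p rewrite ++-assoc P (m ∷ Q) [ y ] | consec-++ (x ∷ P) m (Q ++ [ y ]) =
    All.++⁻ (consec (x ∷ P ++ [ m ])) p

  path-join : ∀ {x m y : A} P Q → Path R x P m → Path R m Q y → Path R x (P ++ m ∷ Q) y
  path-join {x} {m} {y} P Q p q rewrite ++-assoc P (m ∷ Q) [ y ] | consec-++ (x ∷ P) m (Q ++ [ y ]) =
    All.++⁺ p q

  path-first : ∀ {x y : A} ms → Path R x ms y → R x (firstOr y ms)
  path-first []      (r ∷ _) = r
  path-first (m ∷ _) (r ∷ _) = r

  path-transport : ∀ (P : A → Set) → (∀ {a b} → R a b → P a → P b) → ∀ {x y} ms → Path R x ms y → P x → P y
  path-transport P step []       (r ∷ [])  Px = step r Px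
  path-transport P step (m ∷ ms) (r ∷ rs)  Px = path-transport P step ms rs (step r Px)

  path-transport⁻ : ∀ (P : A → Set) → (∀ {a b} → R a b → P b → P a) → ∀ {x y} ms → Path R x ms y → P y → P x
  path-transport⁻ P step []       (r ∷ [])  Py = step r Py
  path-transport⁻ P step (m ∷ ms) (r ∷ rs)  Py = step r (path-transport⁻ P step ms rs Py)

  path-dedup : DecidableEquality A → ∀ {x y} ms → Path R x ms y →
               ∃ λ ms′ → Unique ms′ × ms′ ⊆ ms × Path R x ms′ y
  path-dedup _≟_ []       p        = [] , [] , id , p
  path-dedup _≟_ (m ∷ ms) (r ∷ rs) with path-dedup _≟_ ms rs
  ... | ms′ , u , ms′⊆ms , p′ with m ∈? ms′
    where open import Data.List.Membership.DecPropositional _≟_ using (_∈?_)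
  ...   | no m∉ms′ = m ∷ ms′ , ∉⇒Unique-∷ m∉ms′ u , (λ { (here refl) → here refl ; (there w∈) → there (ms′⊆ms w∈) }) , r ∷ p′
  ...   | yes m∈ms′ with ∈-∃++ m∈ms′
  ...     | P , Q , refl = m ∷ Q , Unique-++⁻ʳ P u , (λ { (here refl) → here refl ; (there w∈) → there (ms′⊆ms (∈-++⁺ʳ P (there w∈))) }) ,
                           r ∷ proj₂ (path-split P m Q p′)

-- Counting and reachability

Unique⇒length≤ : ∀ {n} (xs : List (Fin n)) → Unique xs → length xs ℕ.≤ n
Unique⇒length≤ {n} xs u = subst (length xs ℕ.≤_) (length-tabulate id)
  (length-≤-injection xs (allFin n) (λ {x} _ → x) u (λ _ → ∈-allFin _) (λ _ _ → id))

elems : ∀ {m} → (Fin m → Bool) → List (Fin m)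
elems {zero}  P = []
elems {suc m} P with P zero
... | true  = zero ∷ map suc (elems (P ∘ suc))
... | false = map suc (elems (P ∘ suc))

length-elems : ∀ {m} (P : Fin m → Bool) → length (elems P) ≡ count P
length-elems {zero}  P = refl
length-elems {suc m} P with P zero
... | true  = cong suc (trans (length-map suc (elems (P ∘ suc))) (length-elems (P ∘ suc)))
... | false = trans (length-map suc (elems (P ∘ suc))) (length-elems (P ∘ suc))

Unique-elems : ∀ {m} (P : Fin m → Bool) → Unique (elems P)
Unique-elems {zero}  P = []
Unique-elems {suc m} P with P zero
... | true  = ∉⇒Unique-∷ zero∉ (Unique.map⁺ suc-injective (Unique-elems (P ∘ suc)))
  where
  zero∉ : zero ∉ map suc (elems (P ∘ suc))
  zero∉ 0∈ with ∈-map⁻ suc 0∈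
  ... | _ , _ , ()
... | false = Unique.map⁺ suc-injective (Unique-elems (P ∘ suc))

∈-elems⁻ : ∀ {m} (P : Fin m → Bool) {x} → x ∈ elems P → P x ≡ true
∈-elems⁻ {suc m} P x∈ with P zero in P0
∈-elems⁻ {suc m} P (here refl) | true = P0
∈-elems⁻ {suc m} P (there x∈)  | true with ∈-map⁻ suc x∈
... | y , y∈ , refl = ∈-elems⁻ (P ∘ suc) y∈
∈-elems⁻ {suc m} P x∈ | false with ∈-map⁻ suc x∈
... | y , y∈ , refl = ∈-elems⁻ (P ∘ suc) y∈

∈-elems⁺ : ∀ {m} (P : Fin m → Bool) {x} → P x ≡ true → x ∈ elems P
∈-elems⁺ {suc m} P {zero} P0 rewrite P0 = here refl
∈-elems⁺ {suc m} P {suc x} Px with P zero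
... | true  = there (∈-map⁺ suc (∈-elems⁺ (P ∘ suc) Px))
... | false = ∈-map⁺ suc (∈-elems⁺ (P ∘ suc) Px)

count-≤-injection : ∀ {m} (P Q : Fin m → Bool) (f : ∀ x → P x ≡ true → Fin m) →
                    (∀ x Px → Q (f x Px) ≡ true) →
                    (∀ x y Px Py → f x Px ≡ f y Py → x ≡ y) →
                    count P ℕ.≤ count Q
count-≤-injection P Q f maps inj = subst₂ ℕ._≤_ (length-elems P) (length-elems Q)
  (length-≤-injection (elems P) (elems Q) (λ x∈ → f _ (∈-elems⁻ P x∈)) (Unique-elems P)
    (λ x∈ → ∈-elems⁺ Q (maps _ (∈-elems⁻ P x∈)))
    (λ x∈ y∈ → inj _ _ (∈-elems⁻ P x∈) (∈-elems⁻ P y∈)))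

module Reachability {n} (R : Fin n → Fin n → Bool) (c : Fin n) where

  Step : Fin n → Fin n → Set
  Step a b = R a b ≡ true

  within : ℕ → Fin n → Bool
  within zero    w = does (c ≟ w)
  within (suc k) w = within k w ∨ does (any? (λ v → within k v ∧ R v w ≟ᵇ true))

  within-suc : ∀ k {w} → within k w ≡ true → within (suc k) w ≡ true
  within-suc k w∈ rewrite w∈ = refl

  within-mono : ∀ {k k′} → k ℕ.≤ k′ → ∀ {w} → within k w ≡ true → within k′ w ≡ true
  within-mono {k} k≤k′ w∈ with ℕ.≤⇒≤′ k≤k′
  ... | ℕ.≤′-refl = w∈
  ... | ℕ.≤′-step {k′} k≤′k′ = within-suc k′ (within-mono (ℕ.≤′⇒≤ k≤′k′) w∈)

  within-step : ∀ k {v w} → within k v ≡ true → Step v w → within (suc k) w ≡ true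
  within-step k {v} {w} v∈ vw with any? (λ u → within k u ∧ R u w ≟ᵇ true)
  ... | yes _ = ∨-zeroʳ (within k w)
  ... | no ∄u = contradiction (v , subst₂ (λ a b → a ∧ b ≡ true) (sym v∈) (sym vw) refl) ∄u

  within-source : ∀ k → within k c ≡ true
  within-source zero    with c ≟ c
  ... | yes _   = refl
  ... | no c≢c  = contradiction refl c≢c
  within-source (suc k) = within-suc k (within-source k)

  within-complete : ∀ {x w} ms → Path Step x ms w → ∀ k → within k x ≡ true → within (k ℕ.+ suc (length ms)) w ≡ true
  within-complete {w = w} []       (s ∷ []) k x∈ = subst (λ i → within i w ≡ true) (sym (ℕ.+-comm k 1)) (within-step k x∈ s)
  within-complete {w = w} (m ∷ ms) (s ∷ ss) k x∈ =
    subst (λ i → within i w ≡ true) (sym (ℕ.+-suc k (suc (length ms)))) (within-complete ms ss (suc k) (within-step k x∈ s))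

  within-sound : ∀ k {w} → within k w ≡ true → c ≡ w ⊎ ∃ λ ms → Path Step c ms w
  within-sound zero {w} w∈ with c ≟ w
  ... | yes c≡w = inj₁ c≡w
  within-sound (suc k) {w} w∈ with ∨-true⁻ {within k w} w∈
  ... | inj₁ w∈k = within-sound k w∈k
  ... | inj₂ w∈k+1 with any? (λ u → within k u ∧ R u w ≟ᵇ true)
  ...   | yes (v , vw) with within-sound k (∧-conicalˡ _ _ vw)
  ...     | inj₁ refl       = inj₂ ([] , ∧-conicalʳ _ _ vw ∷ [])
  ...     | inj₂ (ms , p)   = inj₂ (ms ++ [ v ] , path-join ms [] p (∧-conicalʳ _ _ vw ∷ []))

  -- A path whose intermediate vertices are distinct has at most n + 1 edges.
  reach : Fin n → Bool
  reach = within (suc n)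

  reach-source : reach c ≡ true
  reach-source = within-source (suc n)

  reach-sound : ∀ {w} → reach w ≡ true → c ≡ w ⊎ ∃ λ ms → Path Step c ms w
  reach-sound = within-sound (suc n)

  reach-closed : ∀ {v w} → reach v ≡ true → Step v w → reach w ≡ true
  reach-closed {v} {w} v∈ s with reach-sound v∈
  ... | inj₁ refl = within-mono {1} {suc n} (s≤s z≤n) (within-step 0 (within-source 0) s)
  ... | inj₂ (ms , p) with path-dedup _≟_ (ms ++ [ v ]) (path-join ms [] p (s ∷ []))
  ...   | ms′ , u , _ , p′ = within-mono {k′ = suc n} (s≤s (Unique⇒length≤ ms′ u)) (within-complete ms′ p′ 0 (within-source 0))

-- Directed cacti

module Cactus {n} (E : Digraph n) (cactus : IsDirectedCactus E) where

  simple : Simple E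
  simple = proj₁ cactus

  Edge : Fin n → Fin n → Set
  Edge a b = E a b ≡ true

  edge⇒≢ : ∀ {a b} → Edge a b → a ≢ b
  edge⇒≢ {a} e refl with trans (sym e) (simple a)
  ... | ()

  cycleOf : ∀ {a b} → Edge a b → List (Fin n)
  cycleOf {a} {b} e = proj₁ (proj₁ (proj₂ (proj₂ cactus) a b e))

  cycleOf-isCycle : ∀ {a b} (e : Edge a b) → IsCycle E (cycleOf e)
  cycleOf-isCycle {a} {b} e = proj₁ (proj₂ (proj₁ (proj₂ (proj₂ cactus) a b e)))

  cycleOf-∋ : ∀ {a b} (e : Edge a b) → OnCycle (cycleOf e) a b
  cycleOf-∋ {a} {b} e = proj₂ (proj₂ (proj₁ (proj₂ (proj₂ cactus) a b e)))

  cycle-edge : ∀ {C} → IsCycle E C → ∀ {a b} → OnCycle C a b → Edge a b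
  cycle-edge (_ , _ , edges) = All.lookup edges

  same-cycle : ∀ {C D a b} → IsCycle E C → IsCycle E D → OnCycle C a b → OnCycle D a b →
               ∀ {c d} → OnCycle D c d → OnCycle C c d
  same-cycle {C} {D} {a} {b} C-cycle D-cycle ab∈C ab∈D {c} {d} =
    Equivalence.from (proj₂ (proj₂ (proj₂ cactus) a b (cycle-edge C-cycle ab∈C)) C D C-cycle D-cycle ab∈C ab∈D c d)

  pred-through : ∀ {v w} (e : Edge v w) → ∃ λ u → OnCycle (cycleOf e) u v
  pred-through e = cycleEdges-pred (cycleOf e) (cycleEdges-∈ˡ (cycleOf e) (cycleOf-∋ e))

  succ-through : ∀ {u v} (e : Edge u v) → ∃ λ w → OnCycle (cycleOf e) v w
  succ-through e = cycleEdges-succ (cycleOf e) (cycleEdges-∈ʳ (cycleOf e) (cycleOf-∋ e))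

  out⇒in-edge : ∀ {v w} (e : Edge v w) → Edge (proj₁ (pred-through e)) v
  out⇒in-edge e = cycle-edge (cycleOf-isCycle e) (proj₂ (pred-through e))

  in⇒out-edge : ∀ {u v} (e : Edge u v) → Edge v (proj₁ (succ-through e))
  in⇒out-edge e = cycle-edge (cycleOf-isCycle e) (proj₂ (succ-through e))

  out⇒in-injective : ∀ {v w₁ w₂} (e₁ : Edge v w₁) (e₂ : Edge v w₂) → proj₁ (pred-through e₁) ≡ proj₁ (pred-through e₂) → w₁ ≡ w₂
  out⇒in-injective {v} {w₁} {w₂} e₁ e₂ u₁≡u₂ = cycleEdges-succ-unique C₁ (proj₁ C₁-cycle) (cycleOf-∋ e₁) vw₂∈C₁
    where
    C₁ : List (Fin n)
    C₁ = cycleOf e₁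
    C₁-cycle : IsCycle E C₁
    C₁-cycle = cycleOf-isCycle e₁
    u₂v∈C₂ : OnCycle (cycleOf e₂) (proj₁ (pred-through e₁)) v
    u₂v∈C₂ = subst (λ u → OnCycle (cycleOf e₂) u v) (sym u₁≡u₂) (proj₂ (pred-through e₂))
    vw₂∈C₁ : OnCycle C₁ v w₂
    vw₂∈C₁ = same-cycle C₁-cycle (cycleOf-isCycle e₂) (proj₂ (pred-through e₁)) u₂v∈C₂ (cycleOf-∋ e₂)

  in⇒out-injective : ∀ {v u₁ u₂} (e₁ : Edge u₁ v) (e₂ : Edge u₂ v) → proj₁ (succ-through e₁) ≡ proj₁ (succ-through e₂) → u₁ ≡ u₂
  in⇒out-injective {v} {u₁} {u₂} e₁ e₂ w₁≡w₂ = cycleEdges-pred-unique C₁ (proj₁ C₁-cycle) (cycleOf-∋ e₁) u₂v∈C₁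
    where
    C₁ : List (Fin n)
    C₁ = cycleOf e₁
    C₁-cycle : IsCycle E C₁
    C₁-cycle = cycleOf-isCycle e₁
    vw₂∈C₂ : OnCycle (cycleOf e₂) v (proj₁ (succ-through e₁))
    vw₂∈C₂ = subst (OnCycle (cycleOf e₂) v) (sym w₁≡w₂) (proj₂ (succ-through e₂))
    u₂v∈C₁ : OnCycle C₁ u₂ v
    u₂v∈C₁ = same-cycle C₁-cycle (cycleOf-isCycle e₂) (proj₂ (succ-through e₁)) vw₂∈C₂ (cycleOf-∋ e₂)

  -- Each cycle through v contributes exactly one edge out of v and one edge into v.
  balanced : ∀ v → outdeg E v ≡ outdeg (reverse E) v
  balanced v = ℕ.≤-antisym
    (count-≤-injection (E v) (λ u → E u v) (λ _ → proj₁ ∘ pred-through) (λ _ → out⇒in-edge) (λ _ _ → out⇒in-injective))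
    (count-≤-injection (λ u → E u v) (E v) (λ _ → proj₁ ∘ succ-through) (λ _ → in⇒out-edge) (λ _ _ → in⇒out-injective))

  module Branches {C : List (Fin n)} (C-cycle : IsCycle E C) where

    private
      _∈C? : ∀ v → Dec (v ∈ C)
      v ∈C? = v ∈? C
        where open import Data.List.Membership.DecPropositional _≟_ using (_∈?_)
      onCycle? : ∀ a b → Dec (OnCycle C a b)
      onCycle? a b = (a , b) ∈? cycleEdges C
        where open import Data.List.Membership.DecPropositional (≡-dec _≟_ _≟_) using (_∈?_)

    offCycle : Fin n → Fin n → Bool
    offCycle a b = E a b ∧ not (does (onCycle? a b))

    OffCycle : Fin n → Fin n → Set
    OffCycle a b = offCycle a b ≡ true

    OffCycle⁺ : ∀ {a b} → Edge a b → ¬ OnCycle C a b → OffCycle a b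
    OffCycle⁺ {a} {b} e ab∉C with onCycle? a b
    ... | yes ab∈C = contradiction ab∈C ab∉C
    ... | no _     = cong (_∧ true) e

    OffCycle⁻ : ∀ {a b} → OffCycle a b → Edge a b × ¬ OnCycle C a b
    OffCycle⁻ {a} {b} off with E a b | onCycle? a b
    ... | true | no ab∉C = refl , ab∉C

    -- Splicing the path with the arc of C from y back to x yields a cycle that shares the edge
    -- leaving y with C, hence has the same edges as C, although its first edge is off C.
    no-shortcut : ∀ {x y} ms → x ∈ C → y ∈ C → x ≢ y → (∀ {m} → m ∈ ms → m ∉ C) → Path OffCycle x ms y → ⊥
    no-shortcut {x} {y} ms x∈C y∈C x≢y ms∩C=∅ p with path-dedup _≟_ ms p | rotate C x∈C
    ... | ms′ , ms′-unique , ms′⊆ms , p′ | R , C↭xR , xR⊆C with ∈-resp-↭ C↭xR y∈C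
    ...   | here y≡x  = x≢y (sym y≡x)
    ...   | there y∈R with ∈-∃++ y∈R
    ...     | B , D , refl = proj₂ (OffCycle⁻ (path-first ms′ p′)) (same-cycle C-cycle C′-cycle shared∈C shared∈C′ first∈C′)
      where
      xByD-unique : Unique (x ∷ B ++ y ∷ D)
      xByD-unique = Unique-resp-↭ C↭xR (proj₁ C-cycle)
      ∈xByD⇒∈C : ∀ {v} → v ∈ x ∷ B ++ y ∷ D → v ∈ C
      ∈xByD⇒∈C = ∈-resp-↭ (↭-sym C↭xR)
      C′ : List (Fin n)
      C′ = x ∷ ms′ ++ y ∷ D
      C′-unique : Unique C′
      C′-unique = Unique-splice B D ms′ xByD-unique ms′-unique
                     (λ m∈ms′ m∈xByD → ms∩C=∅ (ms′⊆ms m∈ms′) (∈xByD⇒∈C m∈xByD))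
      C′-length : 2 ℕ.≤ length C′
      C′-length = s≤s (subst (1 ℕ.≤_) (sym (length-++ ms′)) (ℕ.≤-trans (s≤s z≤n) (ℕ.m≤n+m (length (y ∷ D)) (length ms′))))
      C′-edges : All (uncurry Edge) (cycleEdges C′)
      C′-edges = subst (All (uncurry Edge)) (sym (cycleEdges-split x ms′ y D))
        (All.++⁺ (All.map (proj₁ ∘ OffCycle⁻) p′)
                 (All.tabulate (λ e∈ → cycle-edge C-cycle (xR⊆C (arc⊆cycleEdgesʳ x B y D e∈)))))
      C′-cycle : IsCycle E C′
      C′-cycle = C′-unique , C′-length , C′-edges
      shared∈C : OnCycle C y (firstOr x D)
      shared∈C = xR⊆C (arc⊆cycleEdgesʳ x B y D (consec-first y D x))
      shared∈C′ : OnCycle C′ y (firstOr x D)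
      shared∈C′ = arc⊆cycleEdgesʳ x ms′ y D (consec-first y D x)
      first∈C′ : OnCycle C′ x (firstOr y ms′)
      first∈C′ = arc⊆cycleEdgesˡ x ms′ y D (consec-first x ms′ y)

    -- pre collects the intermediate vertices, all off C, that precede the first one on C.
    no-detour : ∀ {x y} pre ms → x ∈ C → y ∈ C → x ≢ y → (∀ {m} → m ∈ pre → m ∉ C) →
                Path OffCycle x (pre ++ ms) y → ⊥
    no-detour pre [] x∈C y∈C x≢y pre∩C=∅ p =
      no-shortcut pre x∈C y∈C x≢y pre∩C=∅ (subst (λ L → Path OffCycle _ L _) (++-identityʳ pre) p)
    no-detour {x} pre (m ∷ ms) x∈C y∈C x≢y pre∩C=∅ p with m ∈C?
    ... | no m∉C = no-detour (pre ++ [ m ]) ms x∈C y∈C x≢y pre′∩C=∅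
                     (subst (λ L → Path OffCycle _ L _) (sym (++-assoc pre [ m ] ms)) p)
      where
      pre′∩C=∅ : ∀ {v} → v ∈ pre ++ [ m ] → v ∉ C
      pre′∩C=∅ v∈ with ∈-++⁻ pre v∈
      ... | inj₁ v∈pre       = pre∩C=∅ v∈pre
      ... | inj₂ (here refl) = m∉C
    ... | yes m∈C with path-split pre m ms p | m ≟ x
    ...   | _      , m⇝y | yes refl = no-detour [] ms m∈C y∈C x≢y (λ ()) m⇝y
    ...   | x⇝m    , _   | no m≢x   = no-shortcut pre x∈C m∈C (m≢x ∘ sym) pre∩C=∅ x⇝m

    -- The rest of the cycle through an off-C edge shares no edge with C.
    off-cycle-return : ∀ {v w} → OffCycle v w → ∃ λ ms → Path OffCycle w ms v
    off-cycle-return {v} {w} vw with OffCycle⁻ vw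
    ... | e , vw∉C with rotate (cycleOf e) (cycleEdges-∈ʳ (cycleOf e) (cycleOf-∋ e))
    ...   | R , C′↭wR , wR⊆C′ with ∈-resp-↭ C′↭wR (cycleEdges-∈ˡ (cycleOf e) (cycleOf-∋ e))
    ...     | here v≡w  = contradiction v≡w (edge⇒≢ e)
    ...     | there v∈R with ∈-∃++ v∈R
    ...       | B , D , refl = B , proj₁ (path-split B v D (All.tabulate off-C))
      where
      off-C : ∀ {f} → f ∈ cycleEdges (w ∷ B ++ v ∷ D) → uncurry OffCycle f
      off-C f∈ = OffCycle⁺ (cycle-edge (cycleOf-isCycle e) (wR⊆C′ f∈))
                   (λ f∈C → vw∉C (same-cycle C-cycle (cycleOf-isCycle e) f∈C (wR⊆C′ f∈) (cycleOf-∋ e)))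

    branch : Fin n → Fin n → Bool
    branch c = Reachability.reach offCycle c

    module _ {c : Fin n} (c∈C : c ∈ C) where

      private
        T : Fin n → Bool
        T = branch c
        open Reachability offCycle c using (reach-source; reach-sound; reach-closed)

      branch-∩-cycle : ∀ {v} → v ∈ C → T v ≡ true → v ≡ c
      branch-∩-cycle {v} v∈C Tv with v ≟ c | reach-sound Tv
      ... | yes v≡c | _             = v≡c
      ... | no v≢c  | inj₁ c≡v      = contradiction (sym c≡v) v≢c
      ... | no v≢c  | inj₂ (ms , p) = ⊥-elim (no-detour [] ms c∈C v∈C (v≢c ∘ sym) (λ ()) p)

      branch-closed⁻ : ∀ {v w} → OffCycle v w → T w ≡ true → T v ≡ true
      branch-closed⁻ vw Tw = let ms , w⇝v = off-cycle-return vw in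
        path-transport (λ u → T u ≡ true) (λ r Ta → reach-closed Ta r) ms w⇝v Tw

      crossing-out : ∀ {v w} → Edge v w → T v ≡ true → not (T w) ≡ true → v ≡ c × OnCycle C v w
      crossing-out {v} {w} e Tv ¬Tw with onCycle? v w
      ... | yes vw∈C = branch-∩-cycle (cycleEdges-∈ˡ C vw∈C) Tv , vw∈C
      ... | no vw∉C  = ⊥-elim (not-true⇒≢true ¬Tw (reach-closed Tv (OffCycle⁺ e vw∉C)))

      crossing-in : ∀ {v w} → Edge v w → not (T v) ≡ true → T w ≡ true → w ≡ c × OnCycle C v w
      crossing-in {v} {w} e ¬Tv Tw with onCycle? v w
      ... | yes vw∈C = branch-∩-cycle (cycleEdges-∈ʳ C vw∈C) Tw , vw∈C
      ... | no vw∉C  = ⊥-elim (not-true⇒≢true ¬Tv (branch-closed⁻ (OffCycle⁺ e vw∉C) Tw))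

      outside-branch : ∀ {v} → v ∈ C → v ≢ c → not (T v) ≡ true
      outside-branch {v} v∈C v≢c with T v in Tv
      ... | true  = contradiction (branch-∩-cycle v∈C Tv) v≢c
      ... | false = refl

      branch-out : ∀ {t} → OnCycle C c t → UniqueCrossing E T (not ∘ T) c t
      branch-out ct∈C = record
        { edge   = cycle-edge C-cycle ct∈C
        ; source = reach-source
        ; target = outside-branch (cycleEdges-∈ʳ C ct∈C) (edge⇒≢ (cycle-edge C-cycle ct∈C) ∘ sym)
        ; unique = λ e Tv ¬Tw → let v≡c , vw∈C = crossing-out e Tv ¬Tw in
                   v≡c , cycleEdges-succ-unique C (proj₁ C-cycle) (subst (λ u → OnCycle C u _) v≡c vw∈C) ct∈C
        }

      branch-in : ∀ {s} → OnCycle C s c → UniqueCrossing E (not ∘ T) T s c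
      branch-in sc∈C = record
        { edge   = cycle-edge C-cycle sc∈C
        ; source = outside-branch (cycleEdges-∈ˡ C sc∈C) (edge⇒≢ (cycle-edge C-cycle sc∈C))
        ; target = reach-source
        ; unique = λ e ¬Tv Tw → let w≡c , vw∈C = crossing-in e ¬Tv Tw in
                   cycleEdges-pred-unique C (proj₁ C-cycle) (subst (OnCycle C _) w≡c vw∈C) sc∈C , w≡c
        }

    branch-disjoint : ∀ {c c′ w} → c ∈ C → c′ ∈ C → c ≢ c′ → branch c w ≡ true → branch c′ w ≡ true → ⊥
    branch-disjoint {c} {c′} c∈C c′∈C c≢c′ Tw T′w with Reachability.reach-sound offCycle c′ T′w
    ... | inj₁ refl       = c≢c′ (sym (branch-∩-cycle c∈C c′∈C Tw))
    ... | inj₂ (ms , c′⇝w) = c≢c′ (sym (branch-∩-cycle c∈C c′∈C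
                                  (path-transport⁻ (λ u → branch c u ≡ true) (branch-closed⁻ c∈C) ms c′⇝w Tw)))

  L : Matrix n
  L = laplacian E

  Lᵀ≡laplacian-reverse : ∀ i j → transpose L i j ≡ laplacian (reverse E) i j
  Lᵀ≡laplacian-reverse = transpose-laplacian E balanced

  Lᵀ-indicator : ∀ {S s s′ r r′} → UniqueCrossing (reverse E) S (not ∘ S) s s′ → UniqueCrossing (reverse E) (not ∘ S) S r r′ →
                 transpose L · (ind ∘ S) ≗ (λ v → δ s v - δ r v)
  Lᵀ-indicator {S} out into v = trans (·-congˡ (transpose L) (laplacian (reverse E)) (ind ∘ S) v (Lᵀ≡laplacian-reverse v))
                                  (laplacian-indicator (reverse E) simple out into v)

  edge-potentials : ∀ {a b} → Edge a b → Potentials L a b 1ℚ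
  edge-potentials {a} {b} e = record
    { y      = ind ∘ not ∘ branch b
    ; z      = ind ∘ branch a
    ; A·y≡δ  = laplacian-indicator E simple
                 (UniqueCrossing-cong (λ _ → refl) (λ _ → sym (not-involutive _)) (branch-in b∈C ab∈C))
                 (UniqueCrossing-cong (λ _ → sym (not-involutive _)) (λ _ → refl) (branch-out b∈C (proj₂ (cycleEdges-succ C b∈C))))
    ; Aᵀ·z≡δ = Lᵀ-indicator (UniqueCrossing-reverse (branch-in a∈C (proj₂ (cycleEdges-pred C a∈C))))
                            (UniqueCrossing-reverse (branch-out a∈C ab∈C))
    ; z≤y    = λ v → ind-≤ (λ Tₐv → ≢true⇒not-true (branch-disjoint a∈C b∈C (edge⇒≢ e) Tₐv))
    ; gap≤   = λ v w → ind-gap≤1 (not (branch b v)) (branch a w)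
    }
    where
    C : List (Fin n)
    C = cycleOf e
    ab∈C : OnCycle C a b
    ab∈C = cycleOf-∋ e
    a∈C : a ∈ C
    a∈C = cycleEdges-∈ˡ C ab∈C
    b∈C : b ∈ C
    b∈C = cycleEdges-∈ʳ C ab∈C
    open Branches (cycleOf-isCycle e)

  walk-potentials : ∀ {p q k} → Walk E p q k → Potentials L p q (ℕtoℚ k)
  walk-potentials nil              = Potentials-refl
  walk-potentials (cons {k = k} e w) =
    subst (Potentials L _ _) (sym (ℕtoℚ-suc k)) (Potentials-trans (edge-potentials e) (walk-potentials w))

  L·1≡0 : L · (λ _ → 1ℚ) ≗ (λ _ → 0ℚ)
  L·1≡0 = laplacian-const E simple 1ℚ

  Lᵀ·1≡0 : transpose L · (λ _ → 1ℚ) ≗ (λ _ → 0ℚ)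
  Lᵀ·1≡0 v = trans (·-congˡ (transpose L) (laplacian (reverse E)) (λ _ → 1ℚ) v (Lᵀ≡laplacian-reverse v))
                   (laplacian-const (reverse E) simple 1ℚ v)

-- Any walk of length d from i to j bounds the resistance.
theorem3p5 : (n : ℕ) (E : Digraph n) → IsDirectedCactus E →
    (Ldag : Matrix n) → IsMoorePenrose (laplacian E) Ldag →
    (i j : Fin n) (d : ℕ) → IsDistance E i j d →
    resistance Ldag i j ≤ ℕtoℚ d
theorem3p5 (suc m) E cactus X mp i j d (i⇝j , _) =
  *-cancelˡ-≤-pos (ℕtoℚ (suc m)) {{normalize-pos (suc m) 1}}
    (resistance-bound i L·1≡0 Lᵀ·1≡0 (λ p → _ , walk-potentials (proj₂ (strongly-connected p i))) (walk-potentials i⇝j))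
  where
  open Cactus E cactus
  open MoorePenrose mp
  strongly-connected : StronglyConnected E
  strongly-connected = proj₁ (proj₂ cactus)
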